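{- Let $P$ be an $\omega$-cpo presentation. If $P$ has a bottom element $\bot$, then $\eta(\bot)$ is a bottom element of $P_\omega$; likewise for top elements. If $P$ has all binary joins and the binary join map $\vee:P\times P\to P$ preserves covers, where $P\times P$ carries the cover relation $(p,q)\triangleleft U\times\{q\}$ for $p\triangleleft U$ and $(p,q)\triangleleft\{p\}\times V$ for $q\triangleleft V$, then $P_\omega$ has all binary joins and $\eta:P\to P_\omega$ preserves them. The same holds with binary meets in place of binary joins.
   Context: Foundations: constructive predicative mathematics (sets in HoTT) with function extensionality and unique choice; enumerable = merely the image of a surjection from $\mathbb{N}$. An $\omega$-cpo is a partial order with joins of enumerable directed subsets; $\omega$-continuous = monotone and preserving these joins. An $\omega$-cpo presentation is a preorder $P$ with a cover relation $p\triangleleft U$ where $U\subseteq P$ is enumerable and directed; a morphism of presentations is a monotone map $f$ with $f(p)\triangleleft f(U)$ whenever $p\triangleleft U$; an $\omega$-cpo is a presentation via $c\triangleleft U\iff c\le\bigvee U$. Assumed: each presentation $P$ has a free $\omega$-cpo $\eta:P\to P_\omega$ (every morphism into an $\omega$-cpo extends uniquely along $\eta$ to an $\omega$-continuous map). -}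

module Defs where

open import Level using (0ℓ)
open import Data.Nat using (ℕ)
open import Data.Product using (Σ; _×_; _,_; proj₁; proj₂)
open import Relation.Binary.PropositionalEquality using (_≡_; refl; cong; trans; subst)
open import Axiom.Extensionality.Propositional using (Extensionality)

isProp : Set → Set
isProp A = (x y : A) → x ≡ y

isSet : Set → Set
isSet A = (x y : A) → isProp (x ≡ y)

FunExt : Set₁
FunExt = Extensionality 0ℓ 0ℓ

Subset : Set → Set₁
Subset A = A → Set

image : {A B : Set} → (A → B) → Subset A → Subset B
image {A} f U y = Σ A λ x → U x × f x ≡ y

Enumerable : {A : Set} → Subset A → Set
Enumerable {A} U =
  Σ (ℕ → A) λ e → ((n : ℕ) → U (e n)) × ((x : A) → U x → Σ ℕ λ n → e n ≡ x)

Directed : {A : Set} → (A → A → Set) → Subset A → Set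
Directed {A} _≤_ U =
  (Σ A U) ×
  ((x y : A) → U x → U y → Σ A λ z → U z × (x ≤ z) × (y ≤ z))

image-enum : {A B : Set} (f : A → B) {U : Subset A} →
             Enumerable U → Enumerable (image f U)
image-enum f (e , inU , surj) =
  (λ n → f (e n)) ,
  (λ n → e n , inU n , refl) ,
  λ { y (x , ux , refl) → let (n , p) = surj x ux in n , cong f p }

image-directed : {A B : Set} {_≤A_ : A → A → Set} {_≤B_ : B → B → Set}
                 (f : A → B) → (∀ {x y} → x ≤A y → f x ≤B f y) →
                 {U : Subset A} → Directed _≤A_ U → Directed _≤B_ (image f U)
image-directed f mono ((x , ux) , dir) =
  (f x , x , ux , refl) ,
  λ { _ _ (x₁ , u₁ , refl) (x₂ , u₂ , refl) →
        let (z , uz , l₁ , l₂) = dir x₁ x₂ u₁ u₂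
        in f z , (z , uz , refl) , mono l₁ , mono l₂ }

record OmegaCpo : Set₁ where
  field
    Carrier    : Set
    _≤_        : Carrier → Carrier → Set
    Carrier-set : isSet Carrier
    ≤-prop     : ∀ x y → isProp (x ≤ y)
    ≤-refl     : ∀ x → x ≤ x
    ≤-trans    : ∀ {x y z} → x ≤ y → y ≤ z → x ≤ z
    ≤-antisym  : ∀ {x y} → x ≤ y → y ≤ x → x ≡ y
    ⋁          : (U : Subset Carrier) → Enumerable U → Directed _≤_ U → Carrier
    ⋁-ub       : ∀ U e d x → U x → x ≤ ⋁ U e d
    ⋁-least    : ∀ U e d y → (∀ x → U x → x ≤ y) → ⋁ U e d ≤ y

open OmegaCpo using (⋁) renaming (Carrier to ∣_∣; _≤_ to _⊢_≤_)

record IsContinuous (D E : OmegaCpo) (g : ∣ D ∣ → ∣ E ∣) : Set₁ where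
  field
    mono : ∀ {x y} → D ⊢ x ≤ y → E ⊢ g x ≤ g y
    pres : ∀ U (e : Enumerable U) (d : Directed (OmegaCpo._≤_ D) U) →
           g (⋁ D U e d) ≡ ⋁ E (image g U) (image-enum g e) (image-directed g mono d)

record Presentation : Set₁ where
  field
    Carrier  : Set
    _≤_      : Carrier → Carrier → Set
    Carrier-set : isSet Carrier
    ≤-prop   : ∀ x y → isProp (x ≤ y)
    ≤-refl   : ∀ x → x ≤ x
    ≤-trans  : ∀ {x y z} → x ≤ y → y ≤ z → x ≤ z
    _◁_      : Carrier → Subset Carrier → Set
    ◁-enum   : ∀ {p U} → p ◁ U → Enumerable U
    ◁-dir    : ∀ {p U} → p ◁ U → Directed _≤_ U

-- Morphism of presentations from P to an ω-cpo D (viewed as the presentation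
-- c ◁ U ⇔ c ≤ ⋁ U): monotone, and f p ◁ f[U] whenever p ◁ U.
record IsMorphism (P : Presentation) (D : OmegaCpo)
                  (f : Presentation.Carrier P → ∣ D ∣) : Set₁ where
  private module P = Presentation P
  field
    mono   : ∀ {p q} → p P.≤ q → D ⊢ f p ≤ f q
    covers : ∀ {p U} (c : p P.◁ U) →
             D ⊢ f p ≤ (⋁ D (image f U) (image-enum f (P.◁-enum c))
                              (image-directed f mono (P.◁-dir c)))

record FreeOmegaCpo (P : Presentation) : Set₂ where
  field
    Pω       : OmegaCpo
    η        : Presentation.Carrier P → ∣ Pω ∣
    η-mor    : IsMorphism P Pω η
    extend   : (D : OmegaCpo) (f : Presentation.Carrier P → ∣ D ∣) →
               IsMorphism P D f → ∣ Pω ∣ → ∣ D ∣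
    extend-cont : ∀ D f (m : IsMorphism P D f) → IsContinuous Pω D (extend D f m)
    extend-η : ∀ D f (m : IsMorphism P D f) p → extend D f m (η p) ≡ f p
    extend-unique : ∀ D f (m : IsMorphism P D f) (g : ∣ Pω ∣ → ∣ D ∣) →
                    IsContinuous Pω D g → (∀ p → g (η p) ≡ f p) →
                    ∀ x → g x ≡ extend D f m x

IsBottom : {A : Set} → (A → A → Set) → A → Set
IsBottom {A} _≤_ b = (x : A) → b ≤ x

IsTop : {A : Set} → (A → A → Set) → A → Set
IsTop {A} _≤_ t = (x : A) → x ≤ t

IsBinJoins : {A : Set} → (A → A → Set) → (A → A → A) → Set
IsBinJoins {A} _≤_ _∨_ = (p q : A) →
  (p ≤ (p ∨ q)) × (q ≤ (p ∨ q)) × ((r : A) → p ≤ r → q ≤ r → (p ∨ q) ≤ r)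

IsBinMeets : {A : Set} → (A → A → Set) → (A → A → A) → Set
IsBinMeets {A} _≤_ _∧_ = (p q : A) →
  ((p ∧ q) ≤ p) × ((p ∧ q) ≤ q) × ((r : A) → r ≤ p → r ≤ q → r ≤ (p ∧ q))

_×ˢ_ : {A B : Set} → Subset A → Subset B → Subset (A × B)
(U ×ˢ V) (a , b) = U a × V b

｛_｝ : {A : Set} → A → Subset A
｛ a ｝ x = x ≡ a

module _ (P : Presentation) where
  open Presentation P

  data ProdCover : Carrier × Carrier → Subset (Carrier × Carrier) → Set₁ where
    left  : ∀ {p q U} → p ◁ U → ProdCover (p , q) (U ×ˢ ｛ q ｝)
    right : ∀ {p q V} → q ◁ V → ProdCover (p , q) (｛ p ｝ ×ˢ V)

  PreservesCovers : (Carrier → Carrier → Carrier) → Set₁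
  PreservesCovers _∙_ =
    ∀ {x W} → ProdCover x W →
      (proj₁ x ∙ proj₂ x) ◁ image (λ y → proj₁ y ∙ proj₂ y) W

-- Everything rests on an induction principle for the free ω-cpo: a proposition that holds on
-- η[P] and is closed under directed joins holds on all of P_ω, because the sub-ω-cpo it cuts
-- out receives η, and by freeness the extension of η into it, followed by the inclusion, is
-- the identity. Bottoms and tops are then immediate. A cover-preserving, monotone p ∙ q is extended one variable at a
-- time to an operation on P_ω that is monotone and preserves directed joins in each variable
-- separately; the defining inequalities of a binary join or meet hold on η[P] × η[P] and
-- survive directed joins in each variable, hence hold everywhere.
module Submission where

open import Defs
open OmegaCpo using (⋁) renaming (Carrier to ∣_∣)
open import Function using (id; _∘_)
open import Data.Product using (Σ; _×_; _,_; proj₁; proj₂)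
open import Data.Product.Properties using (Σ-≡,≡→≡)
open import Relation.Binary.PropositionalEquality using (_≡_; refl; sym; trans; cong; subst)
open import Axiom.UniquenessOfIdentityProofs using (module Constant⇒UIP)

module _ {A : Set} {B : A → Set} (B-prop : ∀ x → isProp (B x)) where

  Σ-≡-prop : {s t : Σ A B} → proj₁ s ≡ proj₁ t → s ≡ t
  Σ-≡-prop {s} {t} e = Σ-≡,≡→≡ (e , B-prop (proj₁ t) _ (proj₂ t))

  Σ-isSet : isSet A → isSet (Σ A B)
  Σ-isSet A-set s t = Constant⇒UIP.≡-irrelevant normalise normalise-constant
    where
    normalise : ∀ {s t : Σ A B} → s ≡ t → s ≡ t
    normalise = Σ-≡-prop ∘ cong proj₁

    normalise-constant : ∀ {s t : Σ A B} (p q : s ≡ t) → normalise p ≡ normalise q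
    normalise-constant {s} {t} p q =
      cong Σ-≡-prop (A-set (proj₁ s) (proj₁ t) (cong proj₁ p) (cong proj₁ q))

module OmegaCpoProperties (D : OmegaCpo) where
  open OmegaCpo D hiding (⋁)

  module _ {X : Set} {_≼_ : X → X → Set}
           (g : X → Carrier) (g-mono : ∀ {x y} → x ≼ y → g x ≤ g y) (U : Subset X) where

    ⋁-image : Enumerable U → Directed _≼_ U → Carrier
    ⋁-image e d = ⋁ D (image g U) (image-enum g e) (image-directed g g-mono d)

    ⋁-image-ub : ∀ e d {u} → U u → g u ≤ ⋁-image e d
    ⋁-image-ub e d {u} Uu = ⋁-ub _ _ _ (g u) (u , Uu , refl)

    ⋁-image-least : ∀ e d {z} → (∀ u → U u → g u ≤ z) → ⋁-image e d ≤ z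
    ⋁-image-least e d {z} h = ⋁-least _ _ _ z λ { _ (u , Uu , refl) → h u Uu }

  ≤-respˡ-≡ : ∀ {x x′ y} → x ≡ x′ → x ≤ y → x′ ≤ y
  ≤-respˡ-≡ refl x≤y = x≤y

  ≤-respʳ-≡ : ∀ {x y y′} → y ≡ y′ → x ≤ y → x ≤ y′
  ≤-respʳ-≡ refl x≤y = x≤y

  ⋁-cong : ∀ {U V} e d e′ d′ → (∀ x → U x → V x) → (∀ x → V x → U x) → ⋁ D U e d ≡ ⋁ D V e′ d′
  ⋁-cong e d e′ d′ U⊆V V⊆U =
    ≤-antisym (⋁-least _ _ _ _ λ x Ux → ⋁-ub _ _ _ x (U⊆V x Ux))
              (⋁-least _ _ _ _ λ x Vx → ⋁-ub _ _ _ x (V⊆U x Vx))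

  Monotone : (Carrier → Carrier) → Set
  Monotone f = ∀ {x y} → x ≤ y → f x ≤ f y

  -- For monotone f this is equivalent to preservation of directed joins.
  Subcontinuous : (Carrier → Carrier) → Set₁
  Subcontinuous f = ∀ U e d z → (∀ u → U u → f u ≤ z) → f (⋁ D U e d) ≤ z

  id-continuous : IsContinuous D D id
  id-continuous = record
    { mono = id
    ; pres = λ U e d → ⋁-cong _ _ _ _ (λ x Ux → x , Ux , refl) λ { _ (x , Ux , refl) → Ux }
    }

  continuous⇒subcontinuous : ∀ {f} → IsContinuous D D f → Subcontinuous f
  continuous⇒subcontinuous {f} f-cont U e d z h =
    ≤-respˡ-≡ (sym (IsContinuous.pres f-cont U e d)) (⋁-image-least f _ U _ d h)

  id-subcontinuous : Subcontinuous id
  id-subcontinuous = ⋁-least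

  const-subcontinuous : ∀ c → Subcontinuous (λ _ → c)
  const-subcontinuous c U e ((u , Uu) , _) z h = h u Uu

  module _ {_⊙_ : Carrier → Carrier → Carrier}
           (⊙-monoˡ : ∀ y → Monotone (_⊙ y)) (⊙-monoʳ : ∀ x → Monotone (x ⊙_)) where

    diagonal-mono : Monotone (λ x → x ⊙ x)
    diagonal-mono x≤y = ≤-trans (⊙-monoˡ _ x≤y) (⊙-monoʳ _ x≤y)

    diagonal-subcontinuous : (∀ y → Subcontinuous (_⊙ y)) → (∀ x → Subcontinuous (x ⊙_)) →
                             Subcontinuous (λ x → x ⊙ x)
    diagonal-subcontinuous ⊙-subˡ ⊙-subʳ U e d z h =
      ⊙-subˡ _ U e d z λ u Uu → ⊙-subʳ u U e d z λ w Uw →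
        let (v , Uv , u≤v , w≤v) = proj₂ d u w Uu Uw
        in ≤-trans (≤-trans (⊙-monoˡ w u≤v) (⊙-monoʳ v w≤v)) (h v Uv)

∘-continuous : ∀ {D E F : OmegaCpo} {f : ∣ D ∣ → ∣ E ∣} {g : ∣ E ∣ → ∣ F ∣} →
               IsContinuous D E f → IsContinuous E F g → IsContinuous D F (g ∘ f)
∘-continuous {F = F} {f} {g} f-cont g-cont = record
  { mono = g-mono ∘ f-mono
  ; pres = λ U e d → trans (cong g (IsContinuous.pres f-cont U e d))
      (trans (IsContinuous.pres g-cont _ _ _)
        (OmegaCpoProperties.⋁-cong F _ _ _ _
          (λ { _ (_ , (x , Ux , refl) , refl) → x , Ux , refl })
          (λ { _ (x , Ux , refl) → f x , (x , Ux , refl) , refl })))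
  }
  where
  open IsContinuous f-cont renaming (mono to f-mono)
  open IsContinuous g-cont renaming (mono to g-mono)

module SubOmegaCpo (D : OmegaCpo) (Q : ∣ D ∣ → Set) (Q-prop : ∀ x → isProp (Q x))
                   (Q-⋁ : ∀ U e d → (∀ x → U x → Q x) → Q (⋁ D U e d)) where
  open OmegaCpo D hiding (⋁)

  _≤Q_ : Σ Carrier Q → Σ Carrier Q → Set
  x ≤Q y = proj₁ x ≤ proj₁ y

  ΣQ : OmegaCpo
  ΣQ = record
    { Carrier     = Σ Carrier Q
    ; _≤_         = _≤Q_
    ; Carrier-set = Σ-isSet Q-prop Carrier-set
    ; ≤-prop      = λ x y → ≤-prop (proj₁ x) (proj₁ y)
    ; ≤-refl      = λ x → ≤-refl (proj₁ x)
    ; ≤-trans     = ≤-trans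
    ; ≤-antisym   = λ x≤y y≤x → Σ-≡-prop Q-prop (≤-antisym x≤y y≤x)
    ; ⋁           = λ U e d → OmegaCpoProperties.⋁-image D {_≼_ = _≤Q_} proj₁ id U e d
                            , Q-⋁ _ _ _ λ { _ ((x , Qx) , _ , refl) → Qx }
    ; ⋁-ub        = λ U e d x Ux → ⋁-ub _ _ _ (proj₁ x) (x , Ux , refl)
    ; ⋁-least     = λ U e d y h → ⋁-least _ _ _ (proj₁ y) λ { _ (x , Ux , refl) → h x Ux }
    }

  proj₁-continuous : IsContinuous ΣQ D proj₁
  proj₁-continuous = record { mono = id ; pres = λ U e d → refl }

module FreeOmegaCpoProperties (P : Presentation) (F : FreeOmegaCpo P) where
  open FreeOmegaCpo F
  open OmegaCpo Pω hiding (⋁)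
  open OmegaCpoProperties Pω
  module P = Presentation P

  η-mono : ∀ {p q} → p P.≤ q → η p ≤ η q
  η-mono = IsMorphism.mono η-mor

  continuous-fixing-η-is-id : ∀ {g} → IsContinuous Pω Pω g → (∀ p → g (η p) ≡ η p) → ∀ x → g x ≡ x
  continuous-fixing-η-is-id {g} g-cont g-η x =
    trans (extend-unique Pω η η-mor g g-cont g-η x)
          (sym (extend-unique Pω η η-mor id id-continuous (λ _ → refl) x))

  ⋁-induction : (Q : Carrier → Set) → (∀ x → isProp (Q x)) →
                (∀ U e d → (∀ x → U x → Q x) → Q (⋁ Pω U e d)) →
                (∀ p → Q (η p)) → ∀ x → Q x
  ⋁-induction Q Q-prop Q-⋁ Q-η x = subst Q (proj₁∘ι̂≡id x) (proj₂ (ι̂ x))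
    where
    open SubOmegaCpo Pω Q Q-prop Q-⋁

    ι : ∀ p → Σ Carrier Q
    ι p = η p , Q-η p

    ι-mor : IsMorphism P ΣQ ι
    ι-mor = record
      { mono   = η-mono
      ; covers = λ c → ≤-trans (IsMorphism.covers η-mor c)
          (⋁-image-least η _ _ _ _ λ u Uu → ⋁-ub _ _ _ (η u) (ι u , (u , Uu , refl) , refl))
      }

    ι̂ : Carrier → Σ Carrier Q
    ι̂ = extend ΣQ ι ι-mor

    proj₁∘ι̂≡id : ∀ x → proj₁ (ι̂ x) ≡ x
    proj₁∘ι̂≡id = continuous-fixing-η-is-id
      (∘-continuous (extend-cont ΣQ ι ι-mor) proj₁-continuous)
      (λ p → cong proj₁ (extend-η ΣQ ι ι-mor p))

  ≤-induction : (f g : Carrier → Carrier) → Subcontinuous f → Monotone g →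
                (∀ p → f (η p) ≤ g (η p)) → ∀ x → f x ≤ g x
  ≤-induction f g f-sub g-mono =
    ⋁-induction (λ x → f x ≤ g x) (λ x → ≤-prop _ _)
      λ U e d f≤g → f-sub U e d _ λ u Uu → ≤-trans (f≤g u Uu) (g-mono (⋁-ub U e d u Uu))

  -- Nested one-variable inductions: inducting on ∀ y → f x y ≤ g x y instead would need
  -- function extensionality to see that this predicate is a proposition.
  ≤-induction₂ : (f g : Carrier → Carrier → Carrier) →
                 (∀ y → Subcontinuous (λ x → f x y)) → (∀ x → Subcontinuous (f x)) →
                 (∀ y → Monotone (λ x → g x y)) → (∀ x → Monotone (g x)) →
                 (∀ p q → f (η p) (η q) ≤ g (η p) (η q)) → ∀ x y → f x y ≤ g x y
  ≤-induction₂ f g f-subˡ f-subʳ g-monoˡ g-monoʳ f≤g x y =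
    ≤-induction (λ x → f x y) (λ x → g x y) (f-subˡ y) (g-monoˡ y)
      (λ p → ≤-induction (f (η p)) (g (η p)) (f-subʳ (η p)) (g-monoʳ (η p)) (f≤g p) y) x

  module Lift (_∙_ : P.Carrier → P.Carrier → P.Carrier)
              (∙-monoˡ : ∀ {p p′ q} → p P.≤ p′ → (p ∙ q) P.≤ (p′ ∙ q))
              (∙-monoʳ : ∀ {p q q′} → q P.≤ q′ → (p ∙ q) P.≤ (p ∙ q′))
              (∙-covers : PreservesCovers P _∙_) where

    ∙-morphismʳ : ∀ p → IsMorphism P Pω (λ q → η (p ∙ q))
    ∙-morphismʳ p = record
      { mono   = η-mono ∘ ∙-monoʳ
      ; covers = λ c → ≤-trans (IsMorphism.covers η-mor (∙-covers (right c)))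
          (⋁-image-least η _ _ _ _ λ { _ ((_ , v) , (refl , Vv) , refl) →
            ⋁-image-ub (λ q → η (p ∙ q)) _ _ _ _ Vv })
      }

    liftʳ : P.Carrier → Carrier → Carrier
    liftʳ p = extend Pω (λ q → η (p ∙ q)) (∙-morphismʳ p)

    liftʳ-continuous : ∀ p → IsContinuous Pω Pω (liftʳ p)
    liftʳ-continuous p = extend-cont Pω _ (∙-morphismʳ p)

    liftʳ-η : ∀ p q → liftʳ p (η q) ≡ η (p ∙ q)
    liftʳ-η p q = extend-η Pω _ (∙-morphismʳ p) q

    liftʳ-monoʳ : ∀ p → Monotone (liftʳ p)
    liftʳ-monoʳ p = IsContinuous.mono (liftʳ-continuous p)

    liftʳ-monoˡ : ∀ {p p′} → p P.≤ p′ → ∀ y → liftʳ p y ≤ liftʳ p′ y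
    liftʳ-monoˡ {p} {p′} p≤p′ = ≤-induction (liftʳ p) (liftʳ p′)
      (continuous⇒subcontinuous (liftʳ-continuous p)) (liftʳ-monoʳ p′)
      λ q → ≤-respˡ-≡ (sym (liftʳ-η p q)) (≤-respʳ-≡ (sym (liftʳ-η p′ q)) (η-mono (∙-monoˡ p≤p′)))

    liftʳ-covers : ∀ {p U} (c : p P.◁ U) y →
                   liftʳ p y ≤ ⋁-image (λ u → liftʳ u y) (λ u≤u′ → liftʳ-monoˡ u≤u′ y)
                                       U (P.◁-enum c) (P.◁-dir c)
    liftʳ-covers {p} {U} c = ≤-induction (liftʳ p) (λ y → ⋁-image (λ u → liftʳ u y) _ U _ _)
      (continuous⇒subcontinuous (liftʳ-continuous p))
      (λ y≤y′ → ⋁-image-least _ _ _ _ _ λ u Uu →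
        ≤-trans (liftʳ-monoʳ u y≤y′) (⋁-image-ub (λ u → liftʳ u _) _ _ _ _ Uu))
      λ q → ≤-respˡ-≡ (sym (liftʳ-η p q))
        (≤-trans (IsMorphism.covers η-mor (∙-covers (left c)))
          (⋁-image-least η _ _ _ _ λ { _ ((u , _) , (Uu , refl) , refl) →
            ≤-respˡ-≡ (liftʳ-η u q) (⋁-image-ub (λ u → liftʳ u (η q)) _ _ _ _ Uu) }))

    liftʳ-morphismˡ : ∀ y → IsMorphism P Pω (λ p → liftʳ p y)
    liftʳ-morphismˡ y = record { mono = λ p≤p′ → liftʳ-monoˡ p≤p′ y ; covers = λ c → liftʳ-covers c y }

    _⊙_ : Carrier → Carrier → Carrier
    x ⊙ y = extend Pω (λ p → liftʳ p y) (liftʳ-morphismˡ y) x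

    ⊙-continuousˡ : ∀ y → IsContinuous Pω Pω (_⊙ y)
    ⊙-continuousˡ y = extend-cont Pω _ (liftʳ-morphismˡ y)

    η⊙ : ∀ p y → η p ⊙ y ≡ liftʳ p y
    η⊙ p y = extend-η Pω _ (liftʳ-morphismˡ y) p

    η⊙η : ∀ p q → η p ⊙ η q ≡ η (p ∙ q)
    η⊙η p q = trans (η⊙ p (η q)) (liftʳ-η p q)

    ⊙-monoˡ : ∀ y → Monotone (_⊙ y)
    ⊙-monoˡ y = IsContinuous.mono (⊙-continuousˡ y)

    ⊙-subcontinuousˡ : ∀ y → Subcontinuous (_⊙ y)
    ⊙-subcontinuousˡ y = continuous⇒subcontinuous (⊙-continuousˡ y)

    ⊙-monoʳ : ∀ x → Monotone (x ⊙_)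
    ⊙-monoʳ x {y} {y′} y≤y′ = ≤-induction (_⊙ y) (_⊙ y′) (⊙-subcontinuousˡ y) (⊙-monoˡ y′)
      (λ p → ≤-respˡ-≡ (sym (η⊙ p y)) (≤-respʳ-≡ (sym (η⊙ p y′)) (liftʳ-monoʳ p y≤y′))) x

    ⊙-subcontinuousʳ : ∀ x → Subcontinuous (x ⊙_)
    ⊙-subcontinuousʳ x W e d z h = ≤-trans (⊙-⋁ʳ x) (⋁-image-least (x ⊙_) _ W e d h)
      where
      ⊙-⋁ʳ : ∀ x → (x ⊙ ⋁ Pω W e d) ≤ ⋁-image (x ⊙_) (⊙-monoʳ x) W e d
      ⊙-⋁ʳ = ≤-induction (_⊙ ⋁ Pω W e d) (λ x → ⋁-image (x ⊙_) (⊙-monoʳ x) W e d)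
        (⊙-subcontinuousˡ _)
        (λ x≤x′ → ⋁-image-least _ _ _ _ _ λ w Ww →
          ≤-trans (⊙-monoˡ w x≤x′) (⋁-image-ub (_ ⊙_) _ _ _ _ Ww))
        λ p → ≤-respˡ-≡ (sym (η⊙ p _))
          (continuous⇒subcontinuous (liftʳ-continuous p) W e d _ λ w Ww →
            ≤-respˡ-≡ (η⊙ p w) (⋁-image-ub (η p ⊙_) _ _ _ _ Ww))

  η-preserves-bottom : ∀ b → IsBottom P._≤_ b → IsBottom _≤_ (η b)
  η-preserves-bottom b b-bottom =
    ≤-induction (λ _ → η b) id (const-subcontinuous (η b)) id (η-mono ∘ b-bottom)

  η-preserves-top : ∀ t → IsTop P._≤_ t → IsTop _≤_ (η t)
  η-preserves-top t t-top = ≤-induction id (λ _ → η t) id-subcontinuous (λ _ → ≤-refl _) (η-mono ∘ t-top)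

  module _ (_∨_ : P.Carrier → P.Carrier → P.Carrier) (∨-joins : IsBinJoins P._≤_ _∨_) where

    ∨-monoˡ : ∀ {p p′ q} → p P.≤ p′ → (p ∨ q) P.≤ (p′ ∨ q)
    ∨-monoˡ {p} {p′} {q} p≤p′ =
      let (_ , q≤p∨q , least) = ∨-joins p q ; (p′≤p′∨q , q≤p′∨q , _) = ∨-joins p′ q
      in least (p′ ∨ q) (P.≤-trans p≤p′ p′≤p′∨q) q≤p′∨q

    ∨-monoʳ : ∀ {p q q′} → q P.≤ q′ → (p ∨ q) P.≤ (p ∨ q′)
    ∨-monoʳ {p} {q} {q′} q≤q′ =
      let (_ , _ , least) = ∨-joins p q ; (p≤p∨q′ , q′≤p∨q′ , _) = ∨-joins p q′
      in least (p ∨ q′) p≤p∨q′ (P.≤-trans q≤q′ q′≤p∨q′)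

    η-preserves-joins : PreservesCovers P _∨_ →
      Σ (Carrier → Carrier → Carrier) λ _⊔_ → IsBinJoins _≤_ _⊔_ × (∀ p q → η (p ∨ q) ≡ (η p ⊔ η q))
    η-preserves-joins ∨-covers = _⊙_ , ⊙-joins , λ p q → sym (η⊙η p q)
      where
      open Lift _∨_ ∨-monoˡ ∨-monoʳ ∨-covers

      ⊙-idem : ∀ x → (x ⊙ x) ≤ x
      ⊙-idem = ≤-induction (λ x → x ⊙ x) id
        (diagonal-subcontinuous ⊙-monoˡ ⊙-monoʳ ⊙-subcontinuousˡ ⊙-subcontinuousʳ) id
        λ p → ≤-respˡ-≡ (sym (η⊙η p p)) (η-mono (proj₂ (proj₂ (∨-joins p p)) p (P.≤-refl p) (P.≤-refl p)))

      ⊙-joins : IsBinJoins _≤_ _⊙_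
      ⊙-joins x y =
          ≤-induction₂ (λ x _ → x) _⊙_ (λ _ → id-subcontinuous) const-subcontinuous ⊙-monoˡ ⊙-monoʳ
            (λ p q → ≤-respʳ-≡ (sym (η⊙η p q)) (η-mono (proj₁ (∨-joins p q)))) x y
        , ≤-induction₂ (λ _ y → y) _⊙_ (λ y → const-subcontinuous y) (λ _ → id-subcontinuous) ⊙-monoˡ ⊙-monoʳ
            (λ p q → ≤-respʳ-≡ (sym (η⊙η p q)) (η-mono (proj₁ (proj₂ (∨-joins p q))))) x y
        , λ z x≤z y≤z → ≤-trans (⊙-monoˡ y x≤z) (≤-trans (⊙-monoʳ z y≤z) (⊙-idem z))

  module _ (_∧_ : P.Carrier → P.Carrier → P.Carrier) (∧-meets : IsBinMeets P._≤_ _∧_) where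

    ∧-monoˡ : ∀ {p p′ q} → p P.≤ p′ → (p ∧ q) P.≤ (p′ ∧ q)
    ∧-monoˡ {p} {p′} {q} p≤p′ =
      let (p∧q≤p , p∧q≤q , _) = ∧-meets p q ; (_ , _ , greatest) = ∧-meets p′ q
      in greatest (p ∧ q) (P.≤-trans p∧q≤p p≤p′) p∧q≤q

    ∧-monoʳ : ∀ {p q q′} → q P.≤ q′ → (p ∧ q) P.≤ (p ∧ q′)
    ∧-monoʳ {p} {q} {q′} q≤q′ =
      let (p∧q≤p , p∧q≤q , _) = ∧-meets p q ; (_ , _ , greatest) = ∧-meets p q′
      in greatest (p ∧ q) p∧q≤p (P.≤-trans p∧q≤q q≤q′)

    η-preserves-meets : PreservesCovers P _∧_ →
      Σ (Carrier → Carrier → Carrier) λ _⊓_ → IsBinMeets _≤_ _⊓_ × (∀ p q → η (p ∧ q) ≡ (η p ⊓ η q))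
    η-preserves-meets ∧-covers = _⊙_ , ⊙-meets , λ p q → sym (η⊙η p q)
      where
      open Lift _∧_ ∧-monoˡ ∧-monoʳ ∧-covers

      ⊙-idem : ∀ x → x ≤ (x ⊙ x)
      ⊙-idem = ≤-induction id (λ x → x ⊙ x) id-subcontinuous (diagonal-mono ⊙-monoˡ ⊙-monoʳ)
        λ p → ≤-respʳ-≡ (sym (η⊙η p p)) (η-mono (proj₂ (proj₂ (∧-meets p p)) p (P.≤-refl p) (P.≤-refl p)))

      ⊙-meets : IsBinMeets _≤_ _⊙_
      ⊙-meets x y =
          ≤-induction₂ _⊙_ (λ x _ → x) ⊙-subcontinuousˡ ⊙-subcontinuousʳ (λ _ → id) (λ _ _ → ≤-refl _)
            (λ p q → ≤-respˡ-≡ (sym (η⊙η p q)) (η-mono (proj₁ (∧-meets p q)))) x y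
        , ≤-induction₂ _⊙_ (λ _ y → y) ⊙-subcontinuousˡ ⊙-subcontinuousʳ (λ _ _ → ≤-refl _) (λ _ → id)
            (λ p q → ≤-respˡ-≡ (sym (η⊙η p q)) (η-mono (proj₁ (proj₂ (∧-meets p q))))) x y
        , λ z z≤x z≤y → ≤-trans (⊙-idem z) (≤-trans (⊙-monoˡ z z≤x) (⊙-monoʳ x z≤y))

mainTheorem9 : FunExt → (P : Presentation) (F : FreeOmegaCpo P) →
    ((b : Presentation.Carrier P) → IsBottom (Presentation._≤_ P) b →
        IsBottom (OmegaCpo._≤_ (FreeOmegaCpo.Pω F)) (FreeOmegaCpo.η F b))
    × ((t : Presentation.Carrier P) → IsTop (Presentation._≤_ P) t →
        IsTop (OmegaCpo._≤_ (FreeOmegaCpo.Pω F)) (FreeOmegaCpo.η F t))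
    × ((_∨_ : Presentation.Carrier P → Presentation.Carrier P → Presentation.Carrier P) →
        IsBinJoins (Presentation._≤_ P) _∨_ → PreservesCovers P _∨_ →
        Σ (OmegaCpo.Carrier (FreeOmegaCpo.Pω F) → OmegaCpo.Carrier (FreeOmegaCpo.Pω F) →
             OmegaCpo.Carrier (FreeOmegaCpo.Pω F)) λ _⊔_ →
          IsBinJoins (OmegaCpo._≤_ (FreeOmegaCpo.Pω F)) _⊔_
          × ((p q : Presentation.Carrier P) →
               FreeOmegaCpo.η F (p ∨ q) ≡ (FreeOmegaCpo.η F p ⊔ FreeOmegaCpo.η F q)))
    × ((_∧_ : Presentation.Carrier P → Presentation.Carrier P → Presentation.Carrier P) →
        IsBinMeets (Presentation._≤_ P) _∧_ → PreservesCovers P _∧_ →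
        Σ (OmegaCpo.Carrier (FreeOmegaCpo.Pω F) → OmegaCpo.Carrier (FreeOmegaCpo.Pω F) →
             OmegaCpo.Carrier (FreeOmegaCpo.Pω F)) λ _⊓_ →
          IsBinMeets (OmegaCpo._≤_ (FreeOmegaCpo.Pω F)) _⊓_
          × ((p q : Presentation.Carrier P) →
               FreeOmegaCpo.η F (p ∧ q) ≡ (FreeOmegaCpo.η F p ⊓ FreeOmegaCpo.η F q)))
mainTheorem9 _ P F = η-preserves-bottom , η-preserves-top , η-preserves-joins , η-preserves-meets
  where open FreeOmegaCpoProperties P F
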